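{- Let $X$ be a colorable $n$-dimensional pseudomanifold and let $\delta$ be a $2$-coloring of its vertices. Then the number of $\delta$-monochromatic facets of $X$ is even.
   Context: A simplicial complex is a collection $X$ of subsets (faces) of a finite vertex set $V$ closed under taking subsets. The dimension of a face $A$ is $|A|-1$; $\dim X$ is the largest dimension of a face; a facet is a face of dimension $\dim X$; an edge is a $1$-dimensional face. $X$ is pure if every face is contained in some facet. An $n$-dimensional pseudomanifold is a pure $n$-dimensional simplicial complex in which every face of dimension $n-1$ is contained in exactly two facets. A $k$-coloring of $X$ is a map $V\to\{1,\dots,k\}$. An $n$-dimensional pseudomanifold is colorable if it has an $(n+1)$-coloring under which no edge is monochromatic (equivalently, every facet receives all $n+1$ colors). A facet is $\delta$-monochromatic if $\delta$ is constant on its vertices. -}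

module Defs where

open import Data.Nat using (ℕ; zero; suc; _≤_)
open import Data.Fin using (Fin)
open import Data.Fin.Subset using (Subset; _∈_; _⊆_; ∣_∣)
open import Data.Fin.Subset.Properties using (_∈?_)
open import Data.Fin.Properties using (any?; all?; _≟_)
open import Data.Bool using (true; false)
open import Data.Vec using ([]; _∷_)
open import Data.List using (List; []; _∷_; _++_; map; filter; length)
open import Data.Product using (Σ; _×_; _,_; ∃; ∃-syntax)
open import Relation.Binary.PropositionalEquality using (_≡_; _≢_)
open import Relation.Nullary using (¬_; Dec; yes; no)
open import Relation.Unary using (Decidable)
open import Data.Nat using () renaming (_≟_ to _≟ℕ_)
open import Relation.Nullary.Decidable using (_×-dec_)

record SimplicialComplex (v : ℕ) : Set₁ where
  field
    IsFace    : Subset v → Set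
    isFace?   : Decidable IsFace
    downClosed : ∀ {A B} → A ⊆ B → IsFace B → IsFace A
open SimplicialComplex public

-- A face A has dimension |A| - 1, so "A has dimension d" is |A| ≡ d + 1.
HasDim : ∀ {v} → Subset v → ℕ → Set
HasDim A d = ∣ A ∣ ≡ suc d

HasDimension : ∀ {v} → SimplicialComplex v → ℕ → Set
HasDimension X n =
  (∃[ A ] (IsFace X A × HasDim A n)) × (∀ A → IsFace X A → ∣ A ∣ ≤ suc n)

IsFacet : ∀ {v} → SimplicialComplex v → ℕ → Subset v → Set
IsFacet X n A = IsFace X A × HasDim A n

IsPure : ∀ {v} → SimplicialComplex v → ℕ → Set
IsPure X n = ∀ A → IsFace X A → ∃[ F ] (IsFacet X n F × A ⊆ F)

ExactlyTwo : ∀ {v} → (Subset v → Set) → Set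
ExactlyTwo P = ∃[ F₁ ] ∃[ F₂ ] (P F₁ × P F₂ × F₁ ≢ F₂ ×
                 (∀ F → P F → (F ≡ F₁ Data.Sum.⊎ F ≡ F₂)))
  where import Data.Sum

IsPseudomanifold : ∀ {v} → SimplicialComplex v → ℕ → Set
IsPseudomanifold X n =
  HasDimension X n × IsPure X n ×
  (∀ σ → IsFace X σ → ∣ σ ∣ ≡ n →
     ExactlyTwo (λ F → IsFacet X n F × σ ⊆ F))

Coloring : ℕ → ℕ → Set
Coloring v k = Fin v → Fin k

MonochromaticEdge : ∀ {v k} → SimplicialComplex v → Coloring v k → Subset v → Set
MonochromaticEdge X c e =
  IsFace X e × HasDim e 1 × (∀ {i j} → i ∈ e → j ∈ e → c i ≡ c j)

IsColorable : ∀ {v} → SimplicialComplex v → ℕ → Set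
IsColorable X n = Σ (Coloring _ (suc n)) λ c → (∀ e → ¬ MonochromaticEdge X c e)

Monochromatic : ∀ {v k} → Coloring v k → Subset v → Set
Monochromatic δ A = ∃[ col ] (∀ i → i ∈ A → δ i ≡ col)

monochromatic? : ∀ {v k} (δ : Coloring v k) → Decidable (Monochromatic δ)
monochromatic? δ A = any? (λ col → all? (λ i → imp (i ∈? A) (δ i ≟ col)))
  where
  imp : ∀ {P Q : Set} → Dec P → Dec Q → Dec (P → Q)
  imp _ (yes q) = yes (λ _ → q)
  imp (no ¬p) _ = yes (λ p → Data.Empty.⊥-elim (¬p p))
    where import Data.Empty
  imp (yes p) (no ¬q) = no (λ f → ¬q (f p))

allSubsets : (v : ℕ) → List (Subset v)
allSubsets zero = [] ∷ []
allSubsets (suc v) = map (false ∷_) (allSubsets v) ++ map (true ∷_) (allSubsets v)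

isFacet? : ∀ {v} (X : SimplicialComplex v) (n : ℕ) → Decidable (IsFacet X n)
isFacet? X n A = isFace? X A ×-dec (∣ A ∣ ≟ℕ suc n)

numMonoFacets : ∀ {v k} (X : SimplicialComplex v) (n : ℕ) → Coloring v k → ℕ
numMonoFacets {v} X n δ =
  length (filter (λ A → isFacet? X n A ×-dec monochromatic? δ A) (allSubsets v))

module Submission where

-- Let c be a proper (n+1)-colouring of the n-pseudomanifold X and δ a
-- 2-colouring.  A proper colouring makes every facet F rainbow: it has exactly
-- one vertex of each colour a, so δ read off F in colour order is a binary word
-- of length n+1.  Call a word a staircase of type a if it is 1 before
-- position a and 0 after it.  A word matches an odd number of staircase types
-- iff it is constant (staircase-parity), so
--     #monochromatic facets ≡ Σ_a #{facets whose a-ridge follows staircase a}  (mod 2).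
-- Whether F is counted for a depends only on its a-ridge (F minus its vertex
-- of colour a), and that ridge lies in exactly one other facet, which has the
-- same a-ridge; so for each a the counted facets pair up and their number is
-- even (involution-parity).

open import Defs
open import Data.Nat using (ℕ)
open import Data.Nat.Divisibility using (_∣_)

open import Algebra.Bundles using (CommutativeRing)
import Algebra.Properties.CommutativeMonoid.Sum as CommutativeMonoidSum
import Algebra.Properties.Semiring.Sum as SemiringSum
open import Data.Bool using (Bool; true; false; not; _∧_; _∨_; _xor_; T; if_then_else_)
import Data.Bool.Properties as BoolP
open import Data.Empty using (⊥-elim)
open import Data.Fin using (Fin; zero; suc)
open import Data.Fin.Patterns using (0F; 1F)
import Data.Fin.Properties as FinP
open import Data.Fin.Subset using (Subset; _∈_; _⊆_; ∣_∣; ⁅_⁆; _∪_; _∩_; ∁; Nonempty; Lift)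
import Data.Fin.Subset.Properties as SubsetP
open import Data.List using (List; []; _∷_; map; filter; length)
import Data.List.Properties as ListP
open import Data.List.Membership.Propositional using () renaming (_∈_ to _∈ₗ_)
import Data.List.Membership.Propositional.Properties as ∈ₗP
open import Data.List.Relation.Binary.Disjoint.Propositional using (Disjoint)
open import Data.List.Relation.Unary.All as All using ([])
open import Data.List.Relation.Unary.AllPairs using ([]; _∷_)
open import Data.List.Relation.Unary.Any using (here; there)
open import Data.List.Relation.Unary.Unique.Propositional using (Unique)
import Data.List.Relation.Unary.Unique.Propositional.Properties as UniqueP
open import Data.Nat using (zero; suc; _+_; _≤_; z≤n; s≤s)
import Data.Nat.Properties as ℕP
open import Data.Nat.Divisibility using (divides)
open import Data.Product using (_×_; _,_; proj₁; proj₂)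
open import Data.Sum using (_⊎_; inj₁; inj₂)
open import Data.Unit using (tt)
open import Data.Vec using (_∷_; []; tabulate)
open import Data.Vec.Functional using (tail)
import Data.Vec.Properties as VecP
open import Function using (_∘_; _⇔_; mk⇔; Equivalence)
open import Relation.Binary.Definitions using (DecidableEquality)
open import Relation.Binary.PropositionalEquality
open import Relation.Nullary using (¬_; Dec; yes; no; does; ¬?)
open import Relation.Nullary.Decidable using (_×-dec_; T?; does-⇔; dec-true)
open import Relation.Unary using (Decidable)
open ≡-Reasoning

-- Sums over Fin m in the Boolean ring (Bool, xor, ∧): ⊕.sum f is the parity of
-- the number of j with f j = true.
module ⊕ = SemiringSum (CommutativeRing.semiring BoolP.xor-∧-commutativeRing)

module ℕΣ = CommutativeMonoidSum ℕP.+-0-commutativeMonoid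

parity : ∀ {A : Set} → (A → Bool) → List A → Bool
parity f []       = false
parity f (x ∷ xs) = f x xor parity f xs

parity-cong : ∀ {A : Set} {f g : A → Bool} (xs : List A) →
  (∀ x → f x ≡ g x) → parity f xs ≡ parity g xs
parity-cong []       f≗g = refl
parity-cong (x ∷ xs) f≗g = cong₂ _xor_ (f≗g x) (parity-cong xs f≗g)

xor-swap : ∀ a b c → a xor (b xor c) ≡ b xor (a xor c)
xor-swap a b c = trans (sym (BoolP.xor-assoc a b c))
                       (trans (cong (_xor c) (BoolP.xor-comm a b)) (BoolP.xor-assoc b a c))

parity-sum : ∀ {A : Set} {m} (g : A → Fin m → Bool) (xs : List A) →
  parity (λ x → ⊕.sum (g x)) xs ≡ ⊕.sum (λ j → parity (λ x → g x j) xs)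
parity-sum {m = m} g [] = sym (⊕.sum-replicate-zero m)
parity-sum g (x ∷ xs) = begin
  ⊕.sum (g x) xor parity (λ y → ⊕.sum (g y)) xs
    ≡⟨ cong (⊕.sum (g x) xor_) (parity-sum g xs) ⟩
  ⊕.sum (g x) xor ⊕.sum (λ j → parity (λ y → g y j) xs)
    ≡⟨ sym (⊕.∑-distrib-+ (g x) _) ⟩
  ⊕.sum (λ j → parity (λ y → g y j) (x ∷ xs)) ∎

isOdd : ℕ → Bool
isOdd zero    = false
isOdd (suc n) = not (isOdd n)

parity-filter : ∀ {A : Set} {P : A → Set} (P? : Decidable P) (xs : List A) →
  isOdd (length (filter P? xs)) ≡ parity (does ∘ P?) xs
parity-filter P? [] = refl
parity-filter P? (x ∷ xs) with does (P? x)
... | true  = cong not (parity-filter P? xs)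
... | false = parity-filter P? xs

even⇒2∣ : ∀ n → isOdd n ≡ false → 2 ∣ n
even⇒2∣ zero          _    = divides 0 refl
even⇒2∣ (suc zero)    ()
even⇒2∣ (suc (suc n)) even with even⇒2∣ n (trans (sym (BoolP.not-involutive (isOdd n))) even)
... | divides q n≡q*2 = divides (suc q) (cong (λ m → suc (suc m)) n≡q*2)

-- The involution principle: if ι is a fixed-point-free involution on the
-- elements satisfying Q, these elements pair up, so a duplicate-free list
-- closed under ι contains an even number of them.
module Involution {A : Set} (_≟_ : DecidableEquality A) where

  _∖_ : List A → A → List A
  xs ∖ y = filter (λ x → ¬? (x ≟ y)) xs

  parity-remove : ∀ (f : A → Bool) {y xs} → y ∈ₗ xs → Unique xs →
    parity f xs ≡ f y xor parity f (xs ∖ y)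
  parity-remove f {xs = x ∷ xs} (here refl) (x∉xs ∷ _) = cong (λ l → f x xor parity f l) (sym x-removed)
    where
    x-removed : (x ∷ xs) ∖ x ≡ xs
    x-removed = begin
      (x ∷ xs) ∖ x ≡⟨ ListP.filter-reject (λ z → ¬? (z ≟ x)) (λ x≢x → x≢x refl) ⟩
      xs ∖ x       ≡⟨ ListP.filter-all (λ z → ¬? (z ≟ x)) (All.map (λ x≢z → x≢z ∘ sym) x∉xs) ⟩
      xs           ∎
  parity-remove f {y} {x ∷ xs} (there y∈xs) (x∉xs ∷ unique) = begin
    f x xor parity f xs                        ≡⟨ cong (f x xor_) (parity-remove f y∈xs unique) ⟩
    f x xor (f y xor parity f (xs ∖ y))        ≡⟨ xor-swap (f x) (f y) _ ⟩
    f y xor (f x xor parity f (xs ∖ y))        ≡⟨ cong (λ l → f y xor parity f l) (sym x-kept) ⟩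
    f y xor parity f ((x ∷ xs) ∖ y)            ∎
    where
    x-kept : (x ∷ xs) ∖ y ≡ x ∷ (xs ∖ y)
    x-kept = ListP.filter-accept (λ z → ¬? (z ≟ y)) (All.lookup x∉xs y∈xs)

  module _ {Q : A → Set} (Q? : Decidable Q) (ι : A → A)
           (ι-Q : ∀ {x} → Q x → Q (ι x))
           (ι-ι : ∀ {x} → Q x → ι (ι x) ≡ x)
           (ι-≢ : ∀ {x} → Q x → ι x ≢ x) where

    ClosedUnder-ι : List A → Set
    ClosedUnder-ι xs = ∀ {x} → x ∈ₗ xs → Q x → ι x ∈ₗ xs

    -- an element outside Q is nobody's partner, so it can be dropped
    closed-drop : ∀ {x xs} → ¬ Q x → ClosedUnder-ι (x ∷ xs) → ClosedUnder-ι xs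
    closed-drop ¬q closed y∈xs q with closed (there y∈xs) q
    ... | here ιy≡x    = ⊥-elim (¬q (subst Q ιy≡x (ι-Q q)))
    ... | there ιy∈xs = ιy∈xs

    partner-∈ : ∀ {x xs} → Q x → ClosedUnder-ι (x ∷ xs) → ι x ∈ₗ xs
    partner-∈ q closed with closed (here refl) q
    ... | here ιx≡x    = ⊥-elim (ι-≢ q ιx≡x)
    ... | there ιx∈xs = ιx∈xs

    closed-drop-pair : ∀ {x xs} → Q x → Unique (x ∷ xs) → ClosedUnder-ι (x ∷ xs) →
      ClosedUnder-ι (xs ∖ ι x)
    closed-drop-pair {x} {xs} q (x∉xs ∷ _) closed {y} y∈rest qy
      with ∈ₗP.∈-filter⁻ (λ z → ¬? (z ≟ ι x)) y∈rest
    ... | y∈xs , y≢ιx with closed (there y∈xs) qy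
    ...   | here ιy≡x    = ⊥-elim (y≢ιx (trans (sym (ι-ι qy)) (cong ι ιy≡x)))
    ...   | there ιy∈xs = ∈ₗP.∈-filter⁺ (λ z → ¬? (z ≟ ι x)) ιy∈xs ιy≢ιx
      where
      ιy≢ιx : ι y ≢ ι x
      ιy≢ιx ιy≡ιx = All.lookup x∉xs y∈xs (sym (trans (sym (ι-ι qy)) (trans (cong ι ιy≡ιx) (ι-ι q))))

    involution-parity : ∀ xs → Unique xs → ClosedUnder-ι xs → parity (does ∘ Q?) xs ≡ false
    involution-parity xs = go (length xs) xs ℕP.≤-refl
      where
      -- induction on a bound for the length, as a marked head is removed together with its partner
      go : ∀ bound xs → length xs ≤ bound → Unique xs → ClosedUnder-ι xs →
           parity (does ∘ Q?) xs ≡ false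
      go _ [] _ _ _ = refl
      go (suc bound) (x ∷ xs) (s≤s length≤) unique@(_ ∷ unique-xs) closed with Q? x
      ... | no ¬q = go bound xs length≤ unique-xs (closed-drop ¬q closed)
      ... | yes q = cong not (begin
        parity (does ∘ Q?) xs
          ≡⟨ parity-remove _ (partner-∈ q closed) unique-xs ⟩
        does (Q? (ι x)) xor parity (does ∘ Q?) (xs ∖ ι x)
          ≡⟨ cong₂ _xor_ (dec-true (Q? (ι x)) (ι-Q q)) rest ⟩
        true ∎)
        where
        rest : parity (does ∘ Q?) (xs ∖ ι x) ≡ false
        rest = go bound (xs ∖ ι x) (ℕP.≤-trans (ListP.length-filter (λ z → ¬? (z ≟ ι x)) xs) length≤)
                  (UniqueP.filter⁺ (λ z → ¬? (z ≟ ι x)) unique-xs) (closed-drop-pair q unique closed)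

allSubsets-complete : ∀ {v} (A : Subset v) → A ∈ₗ allSubsets v
allSubsets-complete [] = here refl
allSubsets-complete {suc v} (false ∷ A) =
  ∈ₗP.∈-++⁺ˡ (∈ₗP.∈-map⁺ (false ∷_) (allSubsets-complete A))
allSubsets-complete {suc v} (true ∷ A) =
  ∈ₗP.∈-++⁺ʳ (map (false ∷_) (allSubsets v)) (∈ₗP.∈-map⁺ (true ∷_) (allSubsets-complete A))

allSubsets-unique : ∀ v → Unique (allSubsets v)
allSubsets-unique zero = [] ∷ []
allSubsets-unique (suc v) =
  UniqueP.++⁺ (UniqueP.map⁺ VecP.∷-injectiveʳ (allSubsets-unique v))
              (UniqueP.map⁺ VecP.∷-injectiveʳ (allSubsets-unique v)) disjoint
  where
  disjoint : Disjoint (map (false ∷_) (allSubsets v)) (map (true ∷_) (allSubsets v))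
  disjoint (∈false , ∈true) with ∈ₗP.∈-map⁻ (false ∷_) ∈false | ∈ₗP.∈-map⁻ (true ∷_) ∈true
  ... | _ , _ , refl | _ , _ , ()

T-does⁺ : ∀ {P : Set} (a? : Dec P) → P → T (does a?)
T-does⁺ (yes _) _ = tt
T-does⁺ (no ¬p) p = ¬p p

T-does⁻ : ∀ {P : Set} (a? : Dec P) → T (does a?) → P
T-does⁻ (yes p) _ = p

is : Fin 2 → Fin 2 → Bool
is b d = does (d FinP.≟ b)

every : ∀ {m} → (Fin m → Bool) → Bool
every {zero}  f = true
every {suc m} f = f zero ∧ every (tail f)

every-intro : ∀ {m} (f : Fin m → Bool) → (∀ k → T (f k)) → T (every f)
every-intro {zero}  f all = tt
every-intro {suc m} f all = Equivalence.from BoolP.T-∧ (all zero , every-intro (tail f) (λ k → all (suc k)))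

every-elim : ∀ {m} (f : Fin m → Bool) → T (every f) → ∀ k → T (f k)
every-elim {suc m} f t zero    = proj₁ (Equivalence.to BoolP.T-∧ t)
every-elim {suc m} f t (suc k) = every-elim (tail f) (proj₂ (Equivalence.to BoolP.T-∧ t)) k

constant : ∀ {m} → (Fin m → Fin 2) → Bool
constant x = every (is 0F ∘ x) ∨ every (is 1F ∘ x)

-- fits j k d: the staircase of type j (ones before position j, zeros after
-- it, anything at j) admits the letter d at position k.
fits : ∀ {m} → Fin m → Fin m → Fin 2 → Bool
fits zero    zero    d = true
fits zero    (suc k) d = is 0F d
fits (suc j) zero    d = is 1F d
fits (suc j) (suc k) d = fits j k d

fits-diagonal : ∀ {m} (j : Fin m) d → T (fits j j d)
fits-diagonal zero    d = tt
fits-diagonal (suc j) d = fits-diagonal j d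

matches : ∀ {m} → (Fin m → Fin 2) → Fin m → Bool
matches x j = every (λ k → fits j k (x k))

-- Prepending a letter d₀ to a word d₁ ∷ w: the identity behind the inductive
-- step of staircase-parity (here a = every (is 0F) w, b = every (is 1F) w).
constant-cons : ∀ (d₀ d₁ : Fin 2) a b →
  (is 0F d₁ ∧ a) xor (is 1F d₀ ∧ ((is 0F d₁ ∧ a) ∨ (is 1F d₁ ∧ b)))
    ≡ (is 0F d₀ ∧ (is 0F d₁ ∧ a)) ∨ (is 1F d₀ ∧ (is 1F d₁ ∧ b))
constant-cons 0F 0F a b = trans (BoolP.xor-identityʳ a) (sym (BoolP.∨-identityʳ a))
constant-cons 0F 1F a b = refl
constant-cons 1F 0F a b = trans (cong (a xor_) (BoolP.∨-identityʳ a)) (BoolP.xor-same a)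
constant-cons 1F 1F a b = refl

-- A nonempty binary word is a staircase of an odd number of types iff it is
-- constant (1…10…0 with both blocks nonempty has two types, a constant word one).
staircase-parity : ∀ {m} (x : Fin (suc m) → Fin 2) → ⊕.sum (matches x) ≡ constant x
staircase-parity {zero} x with x 0F
... | 0F = refl
... | 1F = refl
staircase-parity {suc m} x = begin
  ⊕.sum (matches x)
    ≡⟨⟩
  every (is 0F ∘ tail x) xor ⊕.sum (λ j → is 1F (x 0F) ∧ matches (tail x) j)
    ≡⟨ cong (every (is 0F ∘ tail x) xor_) (sym (⊕.*-distribˡ-sum (is 1F (x 0F)) (matches (tail x)))) ⟩
  every (is 0F ∘ tail x) xor (is 1F (x 0F) ∧ ⊕.sum (matches (tail x)))
    ≡⟨ cong (λ t → every (is 0F ∘ tail x) xor (is 1F (x 0F) ∧ t)) (staircase-parity (tail x)) ⟩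
  every (is 0F ∘ tail x) xor (is 1F (x 0F) ∧ constant (tail x))
    ≡⟨ constant-cons (x 0F) (x 1F) (every (is 0F ∘ tail (tail x))) (every (is 1F ∘ tail (tail x))) ⟩
  constant x ∎

⊆-card-≡ : ∀ {v} {p q : Subset v} → p ⊆ q → ∣ q ∣ ≤ ∣ p ∣ → p ≡ q
⊆-card-≡ {p = p} {q} p⊆q ∣q∣≤∣p∣ = SubsetP.⊆-antisym p⊆q q⊆p
  where
  q⊆p : q ⊆ p
  q⊆p {x} x∈q with x SubsetP.∈? p
  ... | yes x∈p = x∈p
  ... | no x∉p  = ⊥-elim (ℕP.<⇒≱ (SubsetP.p⊂q⇒∣p∣<∣q∣ (p⊆q , x , x∈q , x∉p)) ∣q∣≤∣p∣)

card-suc⇒nonempty : ∀ {v m} (p : Subset v) → ∣ p ∣ ≡ suc m → Nonempty p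
card-suc⇒nonempty {v} p size with SubsetP.nonempty? p
... | yes nonempty = nonempty
... | no empty = ⊥-elim (ℕP.0≢1+n (trans (sym (SubsetP.∣⊥∣≡0 v))
                          (trans (cong ∣_∣ (sym (SubsetP.Empty-unique {p = p} empty))) size)))

card≤1 : ∀ {v} (p : Subset v) → (∀ {i j} → i ∈ p → j ∈ p → i ≡ j) → ∣ p ∣ ≤ 1
card≤1 {v} p single with SubsetP.nonempty? p
... | no empty =
  subst (_≤ 1) (sym (trans (cong ∣_∣ (SubsetP.Empty-unique {p = p} empty)) (SubsetP.∣⊥∣≡0 v))) z≤n
... | yes (i , i∈p) = ℕP.≤-trans (SubsetP.p⊆q⇒∣p∣≤∣q∣ p⊆⁅i⁆) (ℕP.≤-reflexive (SubsetP.∣⁅x⁆∣≡1 i))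
  where
  p⊆⁅i⁆ : p ⊆ ⁅ i ⁆
  p⊆⁅i⁆ j∈p = subst (_∈ ⁅ i ⁆) (single i∈p j∈p) (SubsetP.x∈⁅x⁆ i)

card-pair : ∀ {v} (i j : Fin v) → i ≢ j → ∣ ⁅ i ⁆ ∪ ⁅ j ⁆ ∣ ≡ 2
card-pair zero    zero    i≢j = ⊥-elim (i≢j refl)
card-pair zero    (suc j) i≢j = cong suc (trans (cong ∣_∣ (SubsetP.∪-identityˡ ⁅ j ⁆)) (SubsetP.∣⁅x⁆∣≡1 j))
card-pair (suc i) zero    i≢j = cong suc (trans (cong ∣_∣ (SubsetP.∪-identityʳ ⁅ i ⁆)) (SubsetP.∣⁅x⁆∣≡1 i))
card-pair (suc i) (suc j) i≢j = card-pair i j (i≢j ∘ cong suc)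

card-split : ∀ {v} (p q : Subset v) → ∣ p ∩ q ∣ + ∣ p ∩ ∁ q ∣ ≡ ∣ p ∣
card-split []         []          = refl
card-split (true ∷ p) (true ∷ q)  = cong suc (card-split p q)
card-split (true ∷ p) (false ∷ q) = trans (ℕP.+-suc _ _) (cong suc (card-split p q))
card-split (false ∷ p) (b ∷ q)    = card-split p q

all-one : ∀ {m} (a : Fin m → ℕ) → (∀ k → a k ≤ 1) → ℕΣ.sum a ≡ m → ∀ k → a k ≡ 1
all-one {suc m} a bounded total = λ
  { zero    → proj₁ head-tail
  ; (suc k) → all-one (tail a) (λ k → bounded (suc k)) (proj₂ head-tail) k }
  where
  sum≤ : ∀ {m} (a : Fin m → ℕ) → (∀ k → a k ≤ 1) → ℕΣ.sum a ≤ m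
  sum≤ {zero}  a bounded = z≤n
  sum≤ {suc m} a bounded = ℕP.+-mono-≤ (bounded zero) (sum≤ (tail a) (λ k → bounded (suc k)))
  split : ∀ {x y} → x ≤ 1 → y ≤ m → x + y ≡ suc m → x ≡ 1 × y ≡ m
  split {zero}        _         y≤m refl = ⊥-elim (ℕP.1+n≰n y≤m)
  split {suc zero}    _         _   sum  = refl , ℕP.suc-injective sum
  split {suc (suc x)} (s≤s ())  _   _
  head-tail : a zero ≡ 1 × ℕΣ.sum (tail a) ≡ m
  head-tail = split (bounded zero) (sum≤ (tail a) (λ k → bounded (suc k))) total

opaque
  colourClass : ∀ {v k} → (Fin v → Fin k) → Fin k → Subset v
  colourClass c a = tabulate (λ i → does (c i FinP.≟ a))

opaque
  unfolding colourClass

  ∈-colourClass⁺ : ∀ {v k} {c : Fin v → Fin k} {a i} → c i ≡ a → i ∈ colourClass c a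
  ∈-colourClass⁺ {c = c} {a} {i} ci≡a =
    VecP.lookup⇒[]= i _ (trans (VecP.lookup∘tabulate _ i) (dec-true (c i FinP.≟ a) ci≡a))

  ∈-colourClass⁻ : ∀ {v k} {c : Fin v → Fin k} {a i} → i ∈ colourClass c a → c i ≡ a
  ∈-colourClass⁻ {c = c} {a} {i} i∈ = T-does⁻ (c i FinP.≟ a)
    (Equivalence.from BoolP.T-≡ (trans (sym (VecP.lookup∘tabulate _ i)) (VecP.[]=⇒lookup i∈)))

  ∑-classes : ∀ {v k} (c : Fin v → Fin k) (p : Subset v) →
    ℕΣ.sum (λ a → ∣ p ∩ colourClass c a ∣) ≡ ∣ p ∣
  ∑-classes {k = k} c []  = ℕΣ.sum-replicate-zero k
  ∑-classes c (false ∷ p) = ∑-classes (tail c) p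
  ∑-classes {k = k} c (true ∷ p) = begin
    ℕΣ.sum (λ a → ∣ does (c 0F FinP.≟ a) ∷ (p ∩ colourClass (tail c) a) ∣)
      ≡⟨ ℕΣ.sum-cong-≗ {x = λ a → ∣ does (c 0F FinP.≟ a) ∷ (p ∩ colourClass (tail c) a) ∣}
                       (λ a → card-∷ (does (c 0F FinP.≟ a)) (p ∩ colourClass (tail c) a)) ⟩
    ℕΣ.sum (λ a → is-c₀ a + in-tail a)
      ≡⟨ ℕΣ.∑-distrib-+ is-c₀ in-tail ⟩
    ℕΣ.sum is-c₀ + ℕΣ.sum in-tail
      ≡⟨ cong₂ _+_ (∑-indicator (c 0F)) (∑-classes (tail c) p) ⟩
    suc ∣ p ∣ ∎
    where
    is-c₀ in-tail : Fin k → ℕ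
    is-c₀ a = if does (c 0F FinP.≟ a) then 1 else 0
    in-tail a = ∣ p ∩ colourClass (tail c) a ∣
    card-∷ : ∀ {v} b (q : Subset v) → ∣ b ∷ q ∣ ≡ (if b then 1 else 0) + ∣ q ∣
    card-∷ true  q = refl
    card-∷ false q = refl
    ∑-indicator : ∀ {k} (x : Fin k) → ℕΣ.sum (λ a → if does (x FinP.≟ a) then 1 else 0) ≡ 1
    ∑-indicator {suc k} zero    = cong suc (ℕΣ.sum-replicate-zero k)
    ∑-indicator         (suc x) = ∑-indicator x

opaque
  ridge : ∀ {v k} → (Fin v → Fin k) → Fin k → Subset v → Subset v
  ridge c a F = F ∩ ∁ (colourClass c a)

opaque
  unfolding ridge

  ∈-ridge⁺ : ∀ {v k} {c : Fin v → Fin k} {a F i} → i ∈ F → c i ≢ a → i ∈ ridge c a F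
  ∈-ridge⁺ i∈F ci≢a = SubsetP.x∈p∩q⁺ (i∈F , SubsetP.x∉p⇒x∈∁p (ci≢a ∘ ∈-colourClass⁻))

  ∈-ridge⁻ : ∀ {v k} {c : Fin v → Fin k} {a F i} → i ∈ ridge c a F → i ∈ F × c i ≢ a
  ∈-ridge⁻ {F = F} i∈ with SubsetP.x∈p∩q⁻ F _ i∈
  ... | i∈F , i∈∁ = i∈F , λ ci≡a → SubsetP.x∈∁p⇒x∉p i∈∁ (∈-colourClass⁺ ci≡a)

  card-ridge : ∀ {v k} (c : Fin v → Fin k) a F → ∣ F ∩ colourClass c a ∣ + ∣ ridge c a F ∣ ≡ ∣ F ∣
  card-ridge c a F = card-split F (colourClass c a)

module ProperColouring {v k} (X : SimplicialComplex v) (c : Coloring v k)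
                       (proper : ∀ e → ¬ MonochromaticEdge X c e) where

  -- Two vertices of a face with the same colour coincide, since otherwise
  -- they would span a monochromatic edge.
  colour-injective : ∀ {A i j} → IsFace X A → i ∈ A → j ∈ A → c i ≡ c j → i ≡ j
  colour-injective {A} {i} {j} face i∈A j∈A same with i FinP.≟ j
  ... | yes i≡j = i≡j
  ... | no i≢j = ⊥-elim (proper edge (downClosed X edge⊆A face , card-pair i j i≢j , monochromatic))
    where
    edge : Subset v
    edge = ⁅ i ⁆ ∪ ⁅ j ⁆
    endpoint : ∀ {x} → x ∈ edge → x ≡ i ⊎ x ≡ j
    endpoint x∈ with SubsetP.x∈p∪q⁻ ⁅ i ⁆ ⁅ j ⁆ x∈
    ... | inj₁ x∈⁅i⁆ = inj₁ (SubsetP.x∈⁅y⁆⇒x≡y i x∈⁅i⁆)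
    ... | inj₂ x∈⁅j⁆ = inj₂ (SubsetP.x∈⁅y⁆⇒x≡y j x∈⁅j⁆)
    edge⊆A : edge ⊆ A
    edge⊆A x∈ with endpoint x∈
    ... | inj₁ refl = i∈A
    ... | inj₂ refl = j∈A
    colour-of-i : ∀ {x} → x ∈ edge → c x ≡ c i
    colour-of-i x∈ with endpoint x∈
    ... | inj₁ refl = refl
    ... | inj₂ refl = sym same
    monochromatic : ∀ {x y} → x ∈ edge → y ∈ edge → c x ≡ c y
    monochromatic x∈ y∈ = trans (colour-of-i x∈) (sym (colour-of-i y∈))

  class-card≤1 : ∀ {A} → IsFace X A → ∀ a → ∣ A ∩ colourClass c a ∣ ≤ 1
  class-card≤1 {A} face a = card≤1 _ (λ i∈ j∈ →
    colour-injective face (proj₁ (split i∈)) (proj₁ (split j∈))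
      (trans (∈-colourClass⁻ (proj₂ (split i∈))) (sym (∈-colourClass⁻ (proj₂ (split j∈))))))
    where
    split : ∀ {x} → x ∈ A ∩ colourClass c a → x ∈ A × x ∈ colourClass c a
    split = SubsetP.x∈p∩q⁻ A (colourClass c a)

  rainbow : ∀ {A} → IsFace X A → ∣ A ∣ ≡ k → ∀ a → ∣ A ∩ colourClass c a ∣ ≡ 1
  rainbow {A} face size = all-one _ (class-card≤1 face) (trans (∑-classes c A) size)

  module RainbowFace {A} (face : IsFace X A) (size : ∣ A ∣ ≡ k) where

    vertexOf : Fin k → Fin v
    vertexOf a = proj₁ (card-suc⇒nonempty (A ∩ colourClass c a) (rainbow face size a))

    vertexOf-∈-class : ∀ a → vertexOf a ∈ A ∩ colourClass c a
    vertexOf-∈-class a = proj₂ (card-suc⇒nonempty (A ∩ colourClass c a) (rainbow face size a))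

    vertexOf-∈ : ∀ a → vertexOf a ∈ A
    vertexOf-∈ a = proj₁ (SubsetP.x∈p∩q⁻ A _ (vertexOf-∈-class a))

    colour-vertexOf : ∀ a → c (vertexOf a) ≡ a
    colour-vertexOf a = ∈-colourClass⁻ (proj₂ (SubsetP.x∈p∩q⁻ A _ (vertexOf-∈-class a)))

    vertexOf-colour : ∀ {i} → i ∈ A → vertexOf (c i) ≡ i
    vertexOf-colour i∈A = colour-injective face (vertexOf-∈ _) i∈A (colour-vertexOf _)

    ridge-card : ∀ a → suc ∣ ridge c a A ∣ ≡ k
    ridge-card a = trans (cong (_+ ∣ ridge c a A ∣) (sym (rainbow face size a)))
                         (trans (card-ridge c a A) size)

_≟ₛ_ : ∀ {v} → DecidableEquality (Subset v)
_≟ₛ_ = VecP.≡-dec BoolP._≟_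

module _ {v} {P : Subset v → Set} where

  partner : ExactlyTwo P → Subset v → Subset v
  partner (F₁ , F₂ , _) F with F ≟ₛ F₁
  ... | yes _ = F₂
  ... | no _  = F₁

  partner-P : ∀ two F → P (partner two F)
  partner-P (F₁ , F₂ , P₁ , P₂ , _) F with F ≟ₛ F₁
  ... | yes _ = P₂
  ... | no _  = P₁

  partner-≢ : ∀ two F → partner two F ≢ F
  partner-≢ (F₁ , F₂ , _ , _ , F₁≢F₂ , _) F with F ≟ₛ F₁
  ... | yes F≡F₁ = λ F₂≡F → F₁≢F₂ (trans (sym F≡F₁) (sym F₂≡F))
  ... | no F≢F₁  = λ F₁≡F → F≢F₁ (sym F₁≡F)

  partner-unique : ∀ two {F G} → P F → P G → G ≢ F → G ≡ partner two F
  partner-unique (F₁ , F₂ , _ , _ , _ , only) {F} {G} pF pG G≢F with F ≟ₛ F₁ | only G pG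
  ... | yes F≡F₁ | inj₁ G≡F₁ = ⊥-elim (G≢F (trans G≡F₁ (sym F≡F₁)))
  ... | yes _    | inj₂ G≡F₂ = G≡F₂
  ... | no _     | inj₁ G≡F₁ = G≡F₁
  ... | no F≢F₁  | inj₂ G≡F₂ with only F pF
  ...   | inj₁ F≡F₁ = ⊥-elim (F≢F₁ F≡F₁)
  ...   | inj₂ F≡F₂ = ⊥-elim (G≢F (trans G≡F₂ (sym F≡F₂)))

module MonochromaticFacets {v n} (X : SimplicialComplex v)
  (ridge-in-two : ∀ σ → IsFace X σ → ∣ σ ∣ ≡ n → ExactlyTwo (λ F → IsFacet X n F × σ ⊆ F))
  (c : Coloring v (suc n)) (proper : ∀ e → ¬ MonochromaticEdge X c e)
  (δ : Coloring v 2) where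

  open ProperColouring X c proper

  ridge-face : ∀ {F} → IsFacet X n F → ∀ a → IsFace X (ridge c a F)
  ridge-face (face , _) a = downClosed X (proj₁ ∘ ∈-ridge⁻) face

  ridge-size : ∀ {F} → IsFacet X n F → ∀ a → ∣ ridge c a F ∣ ≡ n
  ridge-size (face , size) a = ℕP.suc-injective (RainbowFace.ridge-card face size a)

  Staircase : Fin (suc n) → Subset v → Set
  Staircase a σ = Lift (λ i → T (fits a (c i) (δ i))) σ

  staircase? : ∀ a → Decidable (Staircase a)
  staircase? a = SubsetP.Lift? (λ i → T? (fits a (c i) (δ i)))

  Marked : Fin (suc n) → Subset v → Set
  Marked a F = IsFacet X n F × Staircase a (ridge c a F)

  marked? : ∀ a → Decidable (Marked a)
  marked? a F = isFacet? X n F ×-dec staircase? a (ridge c a F)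

  module _ {F} (facet : IsFacet X n F) where
    open RainbowFace (proj₁ facet) (proj₂ facet)

    word : Fin (suc n) → Fin 2
    word a = δ (vertexOf a)

    constant-on⇒ : ∀ b → (∀ i → i ∈ F → δ i ≡ b) → T (every (is b ∘ word))
    constant-on⇒ b on-F = every-intro _ (λ a → T-does⁺ (word a FinP.≟ b) (on-F _ (vertexOf-∈ a)))

    ⇒constant-on : ∀ b → T (every (is b ∘ word)) → ∀ i → i ∈ F → δ i ≡ b
    ⇒constant-on b t i i∈F =
      subst (λ j → δ j ≡ b) (vertexOf-colour i∈F)
            (T-does⁻ (word (c i) FinP.≟ b) (every-elim (is b ∘ word) t (c i)))

    monochromatic⇔constant : Monochromatic δ F ⇔ T (constant word)
    monochromatic⇔constant = mk⇔ to from
      where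
      to : Monochromatic δ F → T (constant word)
      to (0F , on-F) = Equivalence.from BoolP.T-∨ (inj₁ (constant-on⇒ 0F on-F))
      to (1F , on-F) = Equivalence.from BoolP.T-∨ (inj₂ (constant-on⇒ 1F on-F))
      from : T (constant word) → Monochromatic δ F
      from t with Equivalence.to BoolP.T-∨ t
      ... | inj₁ t₀ = 0F , ⇒constant-on 0F t₀
      ... | inj₂ t₁ = 1F , ⇒constant-on 1F t₁

    staircase⇔matches : ∀ a → Staircase a (ridge c a F) ⇔ T (matches word a)
    staircase⇔matches a = mk⇔ to from
      where
      to : Staircase a (ridge c a F) → T (matches word a)
      to follows = every-intro _ fits-at
        where
        -- position a is free; any other position is a vertex of the a-ridge
        fits-at : ∀ k → T (fits a k (word k))
        fits-at k with k FinP.≟ a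
        ... | yes refl = fits-diagonal k _
        ... | no k≢a = subst (λ b → T (fits a b (word k))) (colour-vertexOf k)
                         (follows (∈-ridge⁺ (vertexOf-∈ k) (k≢a ∘ trans (sym (colour-vertexOf k)))))
      from : T (matches word a) → Staircase a (ridge c a F)
      from t {i} i∈ridge = subst (λ j → T (fits a (c i) (δ j)))
                             (vertexOf-colour (proj₁ (∈-ridge⁻ i∈ridge)))
                             (every-elim (λ k → fits a k (word k)) t (c i))

    monochromatic-parity : does (monochromatic? δ F) ≡ ⊕.sum (λ a → does (staircase? a (ridge c a F)))
    monochromatic-parity = begin
      does (monochromatic? δ F)
        ≡⟨ does-⇔ monochromatic⇔constant (monochromatic? δ F) (T? _) ⟩
      constant word
        ≡⟨ sym (staircase-parity word) ⟩
      ⊕.sum (matches word)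
        ≡⟨ ⊕.sum-cong-≗ (λ a → sym (does-⇔ (staircase⇔matches a) (staircase? a _) (T? _))) ⟩
      ⊕.sum (λ a → does (staircase? a (ridge c a F))) ∎

  opposite : Fin (suc n) → Subset v → Subset v
  opposite a F with isFacet? X n F
  ... | yes facet = partner (ridge-in-two (ridge c a F) (ridge-face facet a) (ridge-size facet a)) F
  ... | no _      = F

  module _ {F} (facet : IsFacet X n F) (a : Fin (suc n)) where

    opposite-facet : IsFacet X n (opposite a F) × ridge c a F ⊆ opposite a F
    opposite-facet with isFacet? X n F
    ... | yes facet′ = partner-P (ridge-in-two _ (ridge-face facet′ a) (ridge-size facet′ a)) F
    ... | no ¬facet  = ⊥-elim (¬facet facet)

    opposite-≢ : opposite a F ≢ F
    opposite-≢ with isFacet? X n F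
    ... | yes facet′ = partner-≢ (ridge-in-two _ (ridge-face facet′ a) (ridge-size facet′ a)) F
    ... | no ¬facet  = ⊥-elim (¬facet facet)

    opposite-unique : ∀ {G} → IsFacet X n G → ridge c a F ⊆ G → G ≢ F → G ≡ opposite a F
    opposite-unique G-facet ridge⊆G G≢F with isFacet? X n F
    ... | yes facet′ = partner-unique (ridge-in-two _ (ridge-face facet′ a) (ridge-size facet′ a))
                         (facet , proj₁ ∘ ∈-ridge⁻) (G-facet , ridge⊆G) G≢F
    ... | no ¬facet  = ⊥-elim (¬facet facet)

    ridge-opposite : ridge c a (opposite a F) ≡ ridge c a F
    ridge-opposite = sym (⊆-card-≡ ridge⊆ (ℕP.≤-reflexive
      (trans (ridge-size (proj₁ opposite-facet) a) (sym (ridge-size facet a)))))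
      where
      ridge⊆ : ridge c a F ⊆ ridge c a (opposite a F)
      ridge⊆ i∈ = ∈-ridge⁺ (proj₂ opposite-facet i∈) (proj₂ (∈-ridge⁻ i∈))

  opposite-involutive : ∀ {F} a → IsFacet X n F → opposite a (opposite a F) ≡ F
  opposite-involutive {F} a facet = sym (opposite-unique (proj₁ (opposite-facet facet a)) a facet
    (subst (_⊆ F) (sym (ridge-opposite facet a)) (proj₁ ∘ ∈-ridge⁻))
    (opposite-≢ facet a ∘ sym))

  -- marks depend only on the ridge, so they are carried across it
  marked-opposite : ∀ {a F} → Marked a F → Marked a (opposite a F)
  marked-opposite {a} (facet , follows) =
    proj₁ (opposite-facet facet a) , subst (Staircase a) (sym (ridge-opposite facet a)) follows

  marked-even : ∀ a → parity (does ∘ marked? a) (allSubsets v) ≡ false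
  marked-even a = Involution.involution-parity _≟ₛ_ (marked? a) (opposite a) marked-opposite
    (opposite-involutive a ∘ proj₁) (λ marked → opposite-≢ (proj₁ marked) a)
    (allSubsets v) (allSubsets-unique v) (λ _ _ → allSubsets-complete _)

  monochromatic-facet-parity : ∀ F →
    does (isFacet? X n F ×-dec monochromatic? δ F) ≡ ⊕.sum (λ a → does (marked? a F))
  monochromatic-facet-parity F = by-cases (isFacet? X n F)
    where
    by-cases : (facet? : Dec (IsFacet X n F)) → does facet? ∧ does (monochromatic? δ F)
               ≡ ⊕.sum (λ a → does facet? ∧ does (staircase? a (ridge c a F)))
    by-cases (yes facet) = monochromatic-parity facet
    by-cases (no _)      = sym (⊕.sum-replicate-zero (suc n))

  monochromatic-facets-even :
    parity (λ F → does (isFacet? X n F ×-dec monochromatic? δ F)) (allSubsets v) ≡ false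
  monochromatic-facets-even = begin
    parity (λ F → does (isFacet? X n F ×-dec monochromatic? δ F)) (allSubsets v)
      ≡⟨ parity-cong (allSubsets v) monochromatic-facet-parity ⟩
    parity (λ F → ⊕.sum (λ a → does (marked? a F))) (allSubsets v)
      ≡⟨ parity-sum (λ F a → does (marked? a F)) (allSubsets v) ⟩
    ⊕.sum (λ a → parity (does ∘ marked? a) (allSubsets v))
      ≡⟨ ⊕.sum-cong-≗ marked-even ⟩
    ⊕.sum {suc n} (λ _ → false)
      ≡⟨ ⊕.sum-replicate-zero (suc n) ⟩
    false ∎

lemma3 : ∀ {v : ℕ} (X : SimplicialComplex v) (n : ℕ) →
    IsPseudomanifold X n → IsColorable X n →
    (δ : Coloring v 2) → 2 ∣ numMonoFacets X n δ
lemma3 {v} X n (_ , _ , ridge-in-two) (c , proper) δ = even⇒2∣ _ (begin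
  isOdd (numMonoFacets X n δ)
    ≡⟨ parity-filter (λ A → isFacet? X n A ×-dec monochromatic? δ A) (allSubsets v) ⟩
  parity (λ A → does (isFacet? X n A ×-dec monochromatic? δ A)) (allSubsets v)
    ≡⟨ MonochromaticFacets.monochromatic-facets-even X ridge-in-two c proper δ ⟩
  false ∎)
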